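{- Let $(L,\vee,\wedge,0,1)$ be a complemented lattice and consider the statements: (i) $x^+\vee y^+\le_1(x\wedge y)^+$ for all $x,y\in L$; (ii) for all $x,y\in L$, $x\le y$ implies $y^+\le_1x^+$; (iii) $(x\vee y)^+\le_1x^+\wedge y^+$ for all $x,y\in L$. Then (i) implies (ii), and (ii) is equivalent to (iii).
   Context: A bounded lattice is complemented if every element $a$ has some $b$ with $a\vee b=1$, $a\wedge b=0$ (complements need not be unique); lattices are non-trivial. For $a\in L$, $a^+:=\{x\in L\mid a\vee x=1,\ a\wedge x=0\}$. For $A,B\subseteq L$: $A\vee B:=\{x\vee y\mid x\in A,y\in B\}$, $A\wedge B:=\{x\wedge y\mid x\in A,y\in B\}$, and $A\le_1B$ means that for every $x\in A$ there exists $y\in B$ with $x\le y$. -}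

module Defs where

open import Level using (Level; _⊔_)
open import Data.Product using (Σ; ∃; _×_; _,_)
open import Relation.Nullary using (¬_)
open import Relation.Binary.Lattice using (BoundedLattice)

module _ {c ℓ₁ ℓ₂ : Level} (L : BoundedLattice c ℓ₁ ℓ₂) where
  open BoundedLattice L

  IsComplement : Carrier → Carrier → Set ℓ₁
  IsComplement a b = ((a ∨ b) ≈ ⊤) × ((a ∧ b) ≈ ⊥)

  Complemented : Set (c ⊔ ℓ₁)
  Complemented = ∀ a → ∃ λ b → IsComplement a b

  NonTrivial : Set ℓ₁
  NonTrivial = ¬ (⊤ ≈ ⊥)

  _⁺ : Carrier → Carrier → Set ℓ₁
  (a ⁺) x = IsComplement a x

  _∨ˢ_ : ∀ {ℓa ℓb} → (Carrier → Set ℓa) → (Carrier → Set ℓb) → Carrier → Set (c ⊔ ℓ₁ ⊔ ℓa ⊔ ℓb)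
  (A ∨ˢ B) z = ∃ λ x → ∃ λ y → A x × B y × (z ≈ (x ∨ y))

  _∧ˢ_ : ∀ {ℓa ℓb} → (Carrier → Set ℓa) → (Carrier → Set ℓb) → Carrier → Set (c ⊔ ℓ₁ ⊔ ℓa ⊔ ℓb)
  (A ∧ˢ B) z = ∃ λ x → ∃ λ y → A x × B y × (z ≈ (x ∧ y))

  _≤₁_ : ∀ {ℓa ℓb} → (Carrier → Set ℓa) → (Carrier → Set ℓb) → Set (c ⊔ ℓ₂ ⊔ ℓa ⊔ ℓb)
  A ≤₁ B = ∀ x → A x → ∃ λ y → B y × (x ≤ y)

  Cond-i : Set (c ⊔ ℓ₁ ⊔ ℓ₂)
  Cond-i = ∀ x y → ((x ⁺) ∨ˢ (y ⁺)) ≤₁ ((x ∧ y) ⁺)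

  Cond-ii : Set (c ⊔ ℓ₁ ⊔ ℓ₂)
  Cond-ii = ∀ x y → x ≤ y → (y ⁺) ≤₁ (x ⁺)

  Cond-iii : Set (c ⊔ ℓ₁ ⊔ ℓ₂)
  Cond-iii = ∀ x y → ((x ∨ y) ⁺) ≤₁ ((x ⁺) ∧ˢ (y ⁺))

{-# OPTIONS --safe #-}
-- Read ≤₁ as a preorder on subsets of L, for which A ∧ˢ B is a greatest lower bound of A and B.
-- Condition (ii) says that a ↦ a⁺ is antitone. Then (x ∨ y)⁺ lies below x⁺ and y⁺, hence below
-- x⁺ ∧ˢ y⁺, which is (iii); conversely (iii) gives (ii) because (x ∨ y)⁺ = y⁺ when x ≤ y.
-- For (i) ⇒ (ii) with x ≤ y: y⁺ ≤₁ y⁺ ∨ˢ x⁺ as x has a complement, (i) bounds this by (y ∧ x)⁺,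
-- and y ∧ x ≈ x.
module Submission where

open import Defs
open import Data.Product using (_×_; _,_)
open import Level using (Level)
open import Relation.Binary.Lattice using (BoundedLattice)
open import Relation.Unary using (Pred; _⊆_; Satisfiable)
import Relation.Binary.Lattice.Properties.JoinSemilattice as JoinSemilatticeProperties
import Relation.Binary.Lattice.Properties.MeetSemilattice as MeetSemilatticeProperties

module ≤₁-Properties {c ℓ₁ ℓ₂} (L : BoundedLattice c ℓ₁ ℓ₂) where
  open BoundedLattice L
  open JoinSemilatticeProperties joinSemilattice using (∨-cong)
  open MeetSemilatticeProperties meetSemilattice using (∧-cong)

  private
    variable
      ℓa ℓb ℓc : Level
      A : Pred Carrier ℓa
      B : Pred Carrier ℓb
      C : Pred Carrier ℓc

  ⊆⇒≤₁ : A ⊆ B → _≤₁_ L A B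
  ⊆⇒≤₁ A⊆B x x∈A = x , A⊆B x∈A , refl

  ≤₁-trans : _≤₁_ L A B → _≤₁_ L B C → _≤₁_ L A C
  ≤₁-trans A≤₁B B≤₁C x x∈A with A≤₁B x x∈A
  ... | y , y∈B , x≤y with B≤₁C y y∈B
  ...   | z , z∈C , y≤z = z , z∈C , trans x≤y y≤z

  A≤₁A∨ˢB : Satisfiable B → _≤₁_ L A (_∨ˢ_ L A B)
  A≤₁A∨ˢB (b , b∈B) x x∈A = x ∨ b , (x , b , x∈A , b∈B , Eq.refl) , x≤x∨y x b

  A∧ˢB≤₁A : _≤₁_ L (_∧ˢ_ L A B) A
  A∧ˢB≤₁A z (x , y , x∈A , _ , z≈x∧y) = x , x∈A , trans (reflexive z≈x∧y) (x∧y≤x x y)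

  ∧ˢ-greatest : _≤₁_ L A B → _≤₁_ L A C → _≤₁_ L A (_∧ˢ_ L B C)
  ∧ˢ-greatest A≤₁B A≤₁C x x∈A with A≤₁B x x∈A | A≤₁C x x∈A
  ... | y , y∈B , x≤y | z , z∈C , x≤z =
    y ∧ z , (y , z , y∈B , z∈C , Eq.refl) , ∧-greatest x≤y x≤z

  ⁺-resp-≈ : ∀ {a b} → a ≈ b → _⁺ L a ⊆ _⁺ L b
  ⁺-resp-≈ a≈b (a∨x≈⊤ , a∧x≈⊥) =
    Eq.trans (∨-cong (Eq.sym a≈b) Eq.refl) a∨x≈⊤ , Eq.trans (∧-cong (Eq.sym a≈b) Eq.refl) a∧x≈⊥

proposition2p6 : ∀ {c ℓ₁ ℓ₂} (L : BoundedLattice c ℓ₁ ℓ₂) → NonTrivial L → Complemented L →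
    (Cond-i L → Cond-ii L) × (Cond-ii L → Cond-iii L) × (Cond-iii L → Cond-ii L)
proposition2p6 L _ complemented = i⇒ii , ii⇒iii , iii⇒ii
  where
  open BoundedLattice L
  open JoinSemilatticeProperties joinSemilattice using (x≤y⇒x∨y≈y)
  open MeetSemilatticeProperties meetSemilattice using (y≤x⇒x∧y≈y)
  open ≤₁-Properties L

  i⇒ii : Cond-i L → Cond-ii L
  i⇒ii cond-i x y x≤y =
    ≤₁-trans (A≤₁A∨ˢB (complemented x))
      (≤₁-trans (cond-i y x) (⊆⇒≤₁ (⁺-resp-≈ (y≤x⇒x∧y≈y x≤y))))

  ii⇒iii : Cond-ii L → Cond-iii L
  ii⇒iii cond-ii x y =
    ∧ˢ-greatest (cond-ii x (x ∨ y) (x≤x∨y x y)) (cond-ii y (x ∨ y) (y≤x∨y x y))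

  iii⇒ii : Cond-iii L → Cond-ii L
  iii⇒ii cond-iii x y x≤y =
    ≤₁-trans (⊆⇒≤₁ (⁺-resp-≈ (Eq.sym (x≤y⇒x∨y≈y x≤y))))
      (≤₁-trans (cond-iii x y) A∧ˢB≤₁A)
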